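{- Let $n\ge 1$ and let $a=(a_0,a_1,\ldots,a_{2n-1})$ be a sequence of $2n$ natural numbers with $\sum_{k=0}^{2n-1}a_k\le n-1$. Then there is an odd index $i\in\{0,\ldots,2n-1\}$ such that, setting $b^{(i)}_j=a_{(i+j)\bmod 2n}$ for $j\ge 0$ and $B^{(i)}_j=\sum_{k=0}^{j-1}b^{(i)}_k$, we have $B^{(i)}_j<\frac{j}{2}$ for all integers $j>0$. -}

module Defs where

open import Data.Nat using (ℕ; zero; suc; _+_; _*_; _%_; NonZero)
open import Data.Nat.DivMod using (_mod_)
open import Data.Fin using (Fin; toℕ)

sumTo : (ℕ → ℕ) → ℕ → ℕ
sumTo f zero    = 0
sumTo f (suc j) = sumTo f j + f j

sumFin : {N : ℕ} → (Fin N → ℕ) → ℕ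
sumFin {zero}  a = 0
sumFin {suc N} a = a Data.Fin.zero + sumFin (λ k → a (Data.Fin.suc k))

shift : (N : ℕ) .{{_ : NonZero N}} → (Fin N → ℕ) → ℕ → ℕ → ℕ
shift N a i j = a ((i + j) mod N)

partialSum : (N : ℕ) .{{_ : NonZero N}} → (Fin N → ℕ) → ℕ → ℕ → ℕ
partialSum N a i j = sumTo (shift N a i) j

-- Let b be the 2n-periodic extension of a and gap j = j − 2 (b₀ + ⋯ + b_{j−1}).  Then
-- gap (i + j) − gap i = j − 2 B⁽ⁱ⁾_j, so i is a valid start exactly when gap is strictly
-- larger at every later index.  Over one period gap grows by 2n − 2 Σ a > 0, so the last
-- minimiser g₀ of gap on [0, ∞) exists and is valid.  If g₀ is even, take the last minimiser
-- g₁ of gap on [g₀ + 1, ∞): as gap rises by at most one per step, gap g₁ = gap g₀ + 1, and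
-- since gap k ≡ k (mod 2), g₁ is odd.  Reducing the start modulo 2n keeps it odd.
module Submission where

open import Defs
open import Data.Nat using (ℕ; suc; _+_; _*_; _<_; _≤_; _∸_)
open import Relation.Binary.PropositionalEquality using (_≡_)
open import Data.Fin using (Fin; toℕ)
open import Data.Product using (_×_; _,_; ∃-syntax)

open import Data.Nat using (zero; s≤s⁻¹; z<s; NonZero; >-nonZero⁻¹; _%_; _/_; _<?_)
import Data.Nat.Properties as ℕₚ
open import Data.Nat.DivMod
  using (_mod_; m≡m%n+[m/n]*n; m<n⇒m%n≡m; m%n%n≡m%n; m%n<n; %-distribˡ-+; %-remove-+ˡ; %-remove-+ʳ; m∣n⇒o%n%m≡o%m)
open import Data.Nat.Divisibility using (∣-refl; m∣m*n)
open import Data.Nat.Induction using (<-rec)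
open import Data.Integer as ℤ using (ℤ; +_; _⊖_; 0ℤ; 1ℤ)
import Data.Integer.Properties as ℤₚ
open import Data.Integer.Tactic.RingSolver using (solve-∀)
open import Data.Fin.Properties using (toℕ-injective; toℕ-fromℕ<; toℕ<n)
open import Data.Sum using (_⊎_; inj₁; inj₂)
open import Data.Empty using (⊥-elim)
open import Relation.Nullary using (¬_; yes; no)
open import Relation.Binary.PropositionalEquality using (refl; sym; trans; cong; cong₂; subst; subst₂; module ≡-Reasoning)

sumTo-cong : ∀ {f h} j → (∀ {k} → k < j → f k ≡ h k) → sumTo f j ≡ sumTo h j
sumTo-cong zero    _   = refl
sumTo-cong (suc j) f≗h = cong₂ _+_ (sumTo-cong j (λ k<j → f≗h (ℕₚ.m<n⇒m<1+n k<j))) (f≗h (ℕₚ.n<1+n j))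

sumTo-+ : ∀ f m n → sumTo f (m + n) ≡ sumTo f m + sumTo (λ k → f (m + k)) n
sumTo-+ f m zero    = trans (cong (sumTo f) (ℕₚ.+-identityʳ m)) (sym (ℕₚ.+-identityʳ _))
sumTo-+ f m (suc n) = begin
  sumTo f (m + suc n)                                    ≡⟨ cong (sumTo f) (ℕₚ.+-suc m n) ⟩
  sumTo f (m + n) + f (m + n)                            ≡⟨ cong (_+ f (m + n)) (sumTo-+ f m n) ⟩
  sumTo f m + sumTo (λ k → f (m + k)) n + f (m + n)      ≡⟨ ℕₚ.+-assoc (sumTo f m) _ _ ⟩
  sumTo f m + (sumTo (λ k → f (m + k)) n + f (m + n))    ∎
  where open ≡-Reasoning

sumTo≡sumFin : ∀ {M} (a : Fin M → ℕ) (f : ℕ → ℕ) → (∀ i → f (toℕ i) ≡ a i) → sumTo f M ≡ sumFin a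
sumTo≡sumFin {zero}  a f f≗a = refl
sumTo≡sumFin {suc M} a f f≗a = begin
  sumTo f (1 + M)                                       ≡⟨ sumTo-+ f 1 M ⟩
  f 0 + sumTo (λ k → f (suc k)) M                       ≡⟨ cong₂ _+_ (f≗a Data.Fin.zero) (sumTo≡sumFin _ _ (λ i → f≗a (Data.Fin.suc i))) ⟩
  a Data.Fin.zero + sumFin (λ i → a (Data.Fin.suc i))   ∎
  where open ≡-Reasoning

n<m⇒0<m⊖n : ∀ {m n} → n < m → 0ℤ ℤ.< m ⊖ n
n<m⇒0<m⊖n {m} {n} n<m = subst (ℤ._< m ⊖ n) (ℤₚ.n⊖n≡0 n) (ℤₚ.⊖-monoˡ-< n n<m)

0<m⊖n⇒n<m : ∀ {m n} → 0ℤ ℤ.< m ⊖ n → n < m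
0<m⊖n⇒n<m {m} {n} 0<m⊖n with n <? m
... | yes n<m = n<m
... | no  n≮m = ⊥-elim (ℤₚ.<⇒≱ 0<m⊖n (subst (m ⊖ n ℤ.≤_) (ℤₚ.n⊖n≡0 n) (ℤₚ.⊖-monoˡ-≤ n (ℕₚ.≮⇒≥ n≮m))))

i<i+j : ∀ i {j} → 0ℤ ℤ.< j → i ℤ.< i ℤ.+ j
i<i+j i 0<j = subst (ℤ._< i ℤ.+ _) (ℤₚ.+-identityʳ i) (ℤₚ.+-monoʳ-< i 0<j)

i<i+j⇒0<j : ∀ i {j} → i ℤ.< i ℤ.+ j → 0ℤ ℤ.< j
i<i+j⇒0<j i {j} i<i+j = subst₂ ℤ._<_ (ℤₚ.+-inverseˡ i) (cancel i j) (ℤₚ.+-monoʳ-< (ℤ.- i) i<i+j)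
  where
  cancel : ∀ x y → ℤ.- x ℤ.+ (x ℤ.+ y) ≡ y
  cancel = solve-∀

[m+n]⊖[x+y]≡m⊖x+n⊖y : ∀ m n x y → (m + n) ⊖ (x + y) ≡ (m ⊖ x) ℤ.+ (n ⊖ y)
[m+n]⊖[x+y]≡m⊖x+n⊖y m n x y = begin
  (m + n) ⊖ (x + y)                      ≡⟨ ℤₚ.[+m]-[+n]≡m⊖n (m + n) (x + y) ⟨
  + (m + n) ℤ.- + (x + y)                ≡⟨ cong₂ ℤ._-_ (ℤₚ.pos-+ m n) (ℤₚ.pos-+ x y) ⟩
  (+ m ℤ.+ + n) ℤ.- (+ x ℤ.+ + y)        ≡⟨ interchange (+ m) (+ n) (+ x) (+ y) ⟩
  (+ m ℤ.- + x) ℤ.+ (+ n ℤ.- + y)        ≡⟨ cong₂ ℤ._+_ (ℤₚ.[+m]-[+n]≡m⊖n m x) (ℤₚ.[+m]-[+n]≡m⊖n n y) ⟩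
  (m ⊖ x) ℤ.+ (n ⊖ y)                    ∎
  where
  open ≡-Reasoning
  interchange : ∀ i j k l → (i ℤ.+ j) ℤ.- (k ℤ.+ l) ≡ (i ℤ.- k) ℤ.+ (j ℤ.- l)
  interchange = solve-∀

m⊖x≡n⊖y⇒m+y≡n+x : ∀ m n x y → m ⊖ x ≡ n ⊖ y → m + y ≡ n + x
m⊖x≡n⊖y⇒m+y≡n+x m n x y eq = ℤₚ.+-injective (begin
  + (m + y)      ≡⟨ ℤₚ.pos-+ m y ⟩
  + m ℤ.+ + y    ≡⟨ ℤₚ.i-j≡0⇒i≡j _ _ (trans (regroup (+ m) (+ n) (+ x) (+ y)) (ℤₚ.i≡j⇒i-j≡0 eq′)) ⟩
  + n ℤ.+ + x    ≡⟨ ℤₚ.pos-+ n x ⟨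
  + (n + x)      ∎)
  where
  open ≡-Reasoning
  eq′ : + m ℤ.- + x ≡ + n ℤ.- + y
  eq′ = trans (ℤₚ.[+m]-[+n]≡m⊖n m x) (trans eq (sym (ℤₚ.[+m]-[+n]≡m⊖n n y)))
  regroup : ∀ i j k l → (i ℤ.+ l) ℤ.- (j ℤ.+ k) ≡ (i ℤ.- k) ℤ.- (j ℤ.- l)
  regroup = solve-∀

odd⊎odd-suc : ∀ m → m % 2 ≡ 1 ⊎ suc m % 2 ≡ 1
odd⊎odd-suc m with m % 2 in eq | m%n<n m 2
... | 0           | _     = inj₂ (trans (%-distribˡ-+ 1 m 2) (cong (λ r → (1 + r) % 2) eq))
... | 1           | _     = inj₁ refl
... | suc (suc _) | 2+r<2 = ⊥-elim (ℕₚ.<⇒≱ 2+r<2 (ℕₚ.m≤m+n 2 _))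

odd⇒≡2[m/2]+1 : ∀ m → m % 2 ≡ 1 → m ≡ 2 * (m / 2) + 1
odd⇒≡2[m/2]+1 m odd = begin
  m                    ≡⟨ m≡m%n+[m/n]*n m 2 ⟩
  m % 2 + m / 2 * 2    ≡⟨ cong (_+ m / 2 * 2) odd ⟩
  1 + m / 2 * 2        ≡⟨ ℕₚ.+-comm 1 _ ⟩
  m / 2 * 2 + 1        ≡⟨ cong (_+ 1) (ℕₚ.*-comm (m / 2) 2) ⟩
  2 * (m / 2) + 1      ∎
  where open ≡-Reasoning

gap : (ℕ → ℕ) → ℕ → ℤ
gap b j = j ⊖ 2 * sumTo b j

PrefixSumsBelowHalf : (ℕ → ℕ) → Set
PrefixSumsBelowHalf b = ∀ j → 0 < j → 2 * sumTo b j < j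

gap-+ : ∀ b m n → gap b (m + n) ≡ gap b m ℤ.+ gap (λ k → b (m + k)) n
gap-+ b m n = trans (cong ((m + n) ⊖_) 2*sum≡) ([m+n]⊖[x+y]≡m⊖x+n⊖y m n (2 * sumTo b m) (2 * sumTo (λ k → b (m + k)) n))
  where
  2*sum≡ : 2 * sumTo b (m + n) ≡ 2 * sumTo b m + 2 * sumTo (λ k → b (m + k)) n
  2*sum≡ = trans (cong (2 *_) (sumTo-+ b m n)) (ℕₚ.*-distribˡ-+ 2 (sumTo b m) (sumTo (λ k → b (m + k)) n))

gap-suc : ∀ b k → gap b (suc k) ℤ.≤ ℤ.suc (gap b k)
gap-suc b k = begin
  gap b (suc k)                          ≡⟨ cong (gap b) (ℕₚ.+-comm 1 k) ⟩
  gap b (k + 1)                          ≡⟨ gap-+ b k 1 ⟩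
  gap b k ℤ.+ gap (λ i → b (k + i)) 1    ≤⟨ ℤₚ.+-monoʳ-≤ (gap b k) (ℤₚ.m⊖n≤m 1 (2 * sumTo (λ i → b (k + i)) 1)) ⟩
  gap b k ℤ.+ 1ℤ                         ≡⟨ ℤₚ.+-comm (gap b k) 1ℤ ⟩
  ℤ.suc (gap b k)                        ∎
  where open ℤₚ.≤-Reasoning

gap-periodic : ∀ {b} p → (∀ k → b (p + k) ≡ b k) → ∀ k → gap b (k + p) ≡ gap b k ℤ.+ gap b p
gap-periodic {b} p periodic k = begin
  gap b (k + p)                          ≡⟨ cong (gap b) (ℕₚ.+-comm k p) ⟩
  gap b (p + k)                          ≡⟨ gap-+ b p k ⟩
  gap b p ℤ.+ gap (λ i → b (p + i)) k    ≡⟨ cong (λ s → gap b p ℤ.+ (k ⊖ 2 * s)) (sumTo-cong k (λ {i} _ → periodic i)) ⟩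
  gap b p ℤ.+ gap b k                    ≡⟨ ℤₚ.+-comm (gap b p) (gap b k) ⟩
  gap b k ℤ.+ gap b p                    ∎
  where open ≡-Reasoning

gap-parity : ∀ b g m → gap b m ≡ ℤ.suc (gap b g) → m % 2 ≡ suc g % 2
gap-parity b g m eq = begin
  m % 2                          ≡⟨ %-remove-+ʳ m (m∣m*n {2} (sumTo b g)) ⟨
  (m + 2 * sumTo b g) % 2        ≡⟨ cong (_% 2) (m⊖x≡n⊖y⇒m+y≡n+x m (suc g) (2 * sumTo b m) (2 * sumTo b g) eq′) ⟩
  (suc g + 2 * sumTo b m) % 2    ≡⟨ %-remove-+ʳ (suc g) (m∣m*n {2} (sumTo b m)) ⟩
  suc g % 2                      ∎
  where
  open ≡-Reasoning
  eq′ : gap b m ≡ suc g ⊖ 2 * sumTo b g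
  eq′ = trans eq (ℤₚ.distribʳ-⊖-+-pos 1 g (2 * sumTo b g))

module _ (f : ℕ → ℤ) where

  record LastMinimumOn (s e : ℕ) : Set where
    field
      point   : ℕ
      s≤point : s ≤ point
      point<e : point < e
      minimal : ∀ {m} → s ≤ m → m < e → f point ℤ.≤ f m
      strict  : ∀ {m} → point < m → m < e → f point ℤ.< f m

  private
    endpointMinimum : ∀ {s e} → s ≤ e → (∀ {m} → s ≤ m → m < e → f e ℤ.≤ f m) → LastMinimumOn s (suc e)
    endpointMinimum {s} {e} s≤e fe≤ = record
      { point = e ; s≤point = s≤e ; point<e = ℕₚ.n<1+n e ; minimal = minimal ; strict = strict }
      where
      minimal : ∀ {m} → s ≤ m → m < suc e → f e ℤ.≤ f m
      minimal s≤m m<1+e with ℕₚ.m<1+n⇒m<n∨m≡n m<1+e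
      ... | inj₁ m<e  = fe≤ s≤m m<e
      ... | inj₂ refl = ℤₚ.≤-refl
      strict : ∀ {m} → e < m → m < suc e → f e ℤ.< f m
      strict e<m m<1+e = ⊥-elim (ℕₚ.<⇒≱ e<m (s≤s⁻¹ m<1+e))

    keepMinimum : ∀ {s e} (r : LastMinimumOn s e) → f (LastMinimumOn.point r) ℤ.< f e → LastMinimumOn s (suc e)
    keepMinimum {s} {e} r fp<fe = record
      { point = point ; s≤point = s≤point ; point<e = ℕₚ.m<n⇒m<1+n point<e ; minimal = minimal′ ; strict = strict′ }
      where
      open LastMinimumOn r
      minimal′ : ∀ {m} → s ≤ m → m < suc e → f point ℤ.≤ f m
      minimal′ s≤m m<1+e with ℕₚ.m<1+n⇒m<n∨m≡n m<1+e
      ... | inj₁ m<e  = minimal s≤m m<e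
      ... | inj₂ refl = ℤₚ.<⇒≤ fp<fe
      strict′ : ∀ {m} → point < m → m < suc e → f point ℤ.< f m
      strict′ p<m m<1+e with ℕₚ.m<1+n⇒m<n∨m≡n m<1+e
      ... | inj₁ m<e  = strict p<m m<e
      ... | inj₂ refl = fp<fe

  lastMinimumOn : ∀ {s} e → s < e → LastMinimumOn s e
  lastMinimumOn {s} (suc e) s<1+e with ℕₚ.m<1+n⇒m<n∨m≡n s<1+e
  ... | inj₂ refl = endpointMinimum ℕₚ.≤-refl (λ s≤m m<s → ⊥-elim (ℕₚ.<⇒≱ m<s s≤m))
  ... | inj₁ s<e with lastMinimumOn e s<e
  ...   | r with f e ℤ.≤? f (LastMinimumOn.point r)
  ...     | yes fe≤fp = endpointMinimum (ℕₚ.<⇒≤ s<e) (λ s≤m m<e → ℤₚ.≤-trans fe≤fp (LastMinimumOn.minimal r s≤m m<e))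
  ...     | no  fe≰fp = keepMinimum r (ℤₚ.≰⇒> fe≰fp)

  record LastMinimumFrom (s : ℕ) : Set where
    field
      point   : ℕ
      s≤point : s ≤ point
      minimal : ∀ {m} → s ≤ m → f point ℤ.≤ f m
      strict  : ∀ {m} → point < m → f point ℤ.< f m

  -- The last minimiser on the window [s, s + p) is one on all of [s, ∞):
  -- any later index is one period after a smaller value of f.
  lastMinimumFrom : ∀ p .{{_ : NonZero p}} → (∀ k → f k ℤ.< f (k + p)) → ∀ s → LastMinimumFrom s
  lastMinimumFrom p increasing s = record { point = point ; s≤point = s≤point ; minimal = minimal′ _ ; strict = strict′ }
    where
    open LastMinimumOn (lastMinimumOn (s + p) (ℕₚ.m<m+n s (>-nonZero⁻¹ p)))

    stepBack : ∀ {m} → ¬ m < s + p → s ≤ m ∸ p × m ∸ p < m × f (m ∸ p) ℤ.< f m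
    stepBack {m} m≮s+p =
      ℕₚ.m+n≤o⇒m≤o∸n s s+p≤m ,
      ℕₚ.∸-monoʳ-< (>-nonZero⁻¹ p) p≤m ,
      subst (λ k → f (m ∸ p) ℤ.< f k) (ℕₚ.m∸n+n≡m p≤m) (increasing (m ∸ p))
      where
      s+p≤m = ℕₚ.≮⇒≥ m≮s+p
      p≤m   = ℕₚ.m+n≤o⇒n≤o s s+p≤m

    minimal′ : ∀ m → s ≤ m → f point ℤ.≤ f m
    minimal′ = <-rec _ go
      where
      go : ∀ m → (∀ {m′} → m′ < m → s ≤ m′ → f point ℤ.≤ f m′) → s ≤ m → f point ℤ.≤ f m
      go m rec s≤m with m <? s + p
      ... | yes m<s+p = minimal s≤m m<s+p
      ... | no  m≮s+p = let (s≤m′ , m′<m , fm′<fm) = stepBack m≮s+p in ℤₚ.≤-trans (rec m′<m s≤m′) (ℤₚ.<⇒≤ fm′<fm)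

    strict′ : ∀ {m} → point < m → f point ℤ.< f m
    strict′ {m} point<m with m <? s + p
    ... | yes m<s+p = strict point<m m<s+p
    ... | no  m≮s+p = let (s≤m′ , _ , fm′<fm) = stepBack m≮s+p in ℤₚ.≤-<-trans (minimal′ _ s≤m′) fm′<fm

  lastMinimumFrom-next-level : (∀ k → f (suc k) ℤ.≤ ℤ.suc (f k)) →
    ∀ {s} (r₀ : LastMinimumFrom s) (r₁ : LastMinimumFrom (suc (LastMinimumFrom.point r₀))) →
    f (LastMinimumFrom.point r₁) ≡ ℤ.suc (f (LastMinimumFrom.point r₀))
  lastMinimumFrom-next-level step r₀ r₁ = ℤₚ.≤-antisym
    (ℤₚ.≤-trans (LastMinimumFrom.minimal r₁ ℕₚ.≤-refl) (step _))
    (ℤₚ.i<j⇒suc[i]≤j (LastMinimumFrom.strict r₀ (LastMinimumFrom.s≤point r₁)))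

lastMinimumFrom⇒prefixSumsBelowHalf : ∀ {b s} (r : LastMinimumFrom (gap b) s) →
  PrefixSumsBelowHalf (λ k → b (LastMinimumFrom.point r + k))
lastMinimumFrom⇒prefixSumsBelowHalf {b} r j 0<j =
  0<m⊖n⇒n<m (i<i+j⇒0<j (gap b g) (subst (gap b g ℤ.<_) (gap-+ b g j) (LastMinimumFrom.strict r (ℕₚ.m<m+n g 0<j))))
  where g = LastMinimumFrom.point r

module _ (b : ℕ → ℕ) (p : ℕ) .{{_ : NonZero p}} (periodic : ∀ k → b (p + k) ≡ b k) (sparse : 2 * sumTo b p < p) where

  private
    increasing : ∀ k → gap b k ℤ.< gap b (k + p)
    increasing k = subst (gap b k ℤ.<_) (sym (gap-periodic p periodic k)) (i<i+j (gap b k) (n<m⇒0<m⊖n sparse))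

    r₀ : LastMinimumFrom (gap b) 0
    r₀ = lastMinimumFrom (gap b) p increasing 0

    r₁ : LastMinimumFrom (gap b) (suc (LastMinimumFrom.point r₀))
    r₁ = lastMinimumFrom (gap b) p increasing _

    g₀ g₁ : ℕ
    g₀ = LastMinimumFrom.point r₀
    g₁ = LastMinimumFrom.point r₁

  ∃-odd-prefixSumsBelowHalf : ∃[ g ] g % 2 ≡ 1 × PrefixSumsBelowHalf (λ k → b (g + k))
  ∃-odd-prefixSumsBelowHalf with odd⊎odd-suc g₀
  ... | inj₁ g₀-odd    = g₀ , g₀-odd , lastMinimumFrom⇒prefixSumsBelowHalf r₀
  ... | inj₂ 1+g₀-odd  = g₁ , trans opposite-parity 1+g₀-odd , lastMinimumFrom⇒prefixSumsBelowHalf r₁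
    where
    opposite-parity : g₁ % 2 ≡ suc g₀ % 2
    opposite-parity = gap-parity b g₀ g₁ (lastMinimumFrom-next-level (gap b) (gap-suc b) r₀ r₁)

mod-cong : ∀ {N} .{{_ : NonZero N}} {m k} → m % N ≡ k % N → m mod N ≡ k mod N
mod-cong eq = toℕ-injective (trans (toℕ-fromℕ< _) (trans eq (sym (toℕ-fromℕ< _))))

[m%n+k]%n≡[m+k]%n : ∀ m k n .{{_ : NonZero n}} → (m % n + k) % n ≡ (m + k) % n
[m%n+k]%n≡[m+k]%n m k n = begin
  (m % n + k) % n            ≡⟨ %-distribˡ-+ (m % n) k n ⟩
  (m % n % n + k % n) % n    ≡⟨ cong (λ r → (r + k % n) % n) (m%n%n≡m%n m n) ⟩
  (m % n + k % n) % n        ≡⟨ %-distribˡ-+ m k n ⟨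
  (m + k) % n                ∎
  where open ≡-Reasoning

toℕ-mod-odd : ∀ n .{{_ : NonZero (2 * n)}} g → g % 2 ≡ 1 → toℕ (g mod (2 * n)) ≡ 2 * (g % (2 * n) / 2) + 1
toℕ-mod-odd n g odd =
  trans (toℕ-fromℕ< _) (odd⇒≡2[m/2]+1 _ (trans (m∣n⇒o%n%m≡o%m 2 (2 * n) g (m∣m*n n)) odd))

module _ (N : ℕ) .{{_ : NonZero N}} (a : Fin N → ℕ) where

  shift-periodic : ∀ k → shift N a 0 (N + k) ≡ shift N a 0 k
  shift-periodic k = cong a (mod-cong (%-remove-+ˡ k ∣-refl))

  sumTo-shift≡sumFin : sumTo (shift N a 0) N ≡ sumFin a
  sumTo-shift≡sumFin =
    sumTo≡sumFin a (shift N a 0) (λ i → cong a (toℕ-injective (trans (toℕ-fromℕ< _) (m<n⇒m%n≡m (toℕ<n i)))))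

  partialSum-mod : ∀ g j → partialSum N a (toℕ (g mod N)) j ≡ partialSum N a g j
  partialSum-mod g j = sumTo-cong j (λ {k} _ → cong a (mod-cong (begin
    (toℕ (g mod N) + k) % N    ≡⟨ cong (λ r → (r + k) % N) (toℕ-fromℕ< _) ⟩
    (g % N + k) % N            ≡⟨ [m%n+k]%n≡[m+k]%n g k N ⟩
    (g + k) % N                ∎)))
    where open ≡-Reasoning

mainTheorem10 : (n : ℕ) → 1 ≤ n → (a : Fin (2 * n) → ℕ) → .{{_ : Data.Nat.NonZero (2 * n)}} →
    sumFin a ≤ n ∸ 1 →
    ∃[ i ] ∃[ t ] (toℕ {2 * n} i ≡ 2 * t + 1 × ((j : ℕ) → 0 < j → 2 * partialSum (2 * n) a (toℕ i) j < j))
mainTheorem10 n 1≤n a sum≤n-1 =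
  let (g , g-odd , belowHalf) = ∃-odd-prefixSumsBelowHalf (shift (2 * n) a 0) (2 * n) (shift-periodic (2 * n) a) sparse
  in  g mod (2 * n) , g % (2 * n) / 2 , toℕ-mod-odd n g g-odd ,
      λ j 0<j → subst (λ s → 2 * s < j) (sym (partialSum-mod (2 * n) a g j)) (belowHalf j 0<j)
  where
  sparse : 2 * sumTo (shift (2 * n) a 0) (2 * n) < 2 * n
  sparse = begin-strict
    2 * sumTo (shift (2 * n) a 0) (2 * n)   ≡⟨ cong (2 *_) (sumTo-shift≡sumFin (2 * n) a) ⟩
    2 * sumFin a                            ≤⟨ ℕₚ.*-monoʳ-≤ 2 sum≤n-1 ⟩
    2 * (n ∸ 1)                             <⟨ ℕₚ.*-monoʳ-< 2 (ℕₚ.∸-monoʳ-< z<s 1≤n) ⟩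
    2 * n                                   ∎
    where open ℕₚ.≤-Reasoning
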